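{- Let $n\geq 2$ and let $L_n$ be the line graph of an $n$-dimensional hypercube-like network. Then the vertex connectivity and edge connectivity of $L_n$ satisfy $\kappa(L_n)=\lambda(L_n)=2n-2$.
   Context: For two disjoint graphs $G_1,G_2$ with the same number of vertices and a bijection $f:V(G_1)\to V(G_2)$, $G_1\oplus_f G_2$ denotes the graph obtained from $G_1\cup G_2$ by adding the edges $(v,f(v))$ for all $v\in V(G_1)$. The $n$-dimensional hypercube-like networks are defined recursively: $K_2$ is the only $1$-dimensional hypercube-like network; for $n\geq 2$, if $Q^1_{n-1}$ and $Q^2_{n-1}$ are (disjoint) $(n-1)$-dimensional hypercube-like networks, then $Q^1_{n-1}\oplus_f Q^2_{n-1}$ is an $n$-dimensional hypercube-like network for every bijection $f:V(Q^1_{n-1})\to V(Q^2_{n-1})$. The line graph $L(G)$ of a graph $G$ has vertex set $E(G)$, two vertices being adjacent iff the corresponding edges share an end-vertex. -}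

module Defs where

open import Data.Nat using (ℕ; zero; suc; _≤_)
open import Data.Bool using (Bool; true; false; not; _∧_; _∨_)
import Data.Bool.Properties as BoolP
open import Data.Vec using (Vec; []; _∷_)
import Data.Vec.Properties as VecP
open import Data.Product using (Σ; ∃; _×_; _,_; proj₁; proj₂; swap)
open import Data.Sum using (_⊎_)
open import Data.List using (List; length)
open import Data.List.Membership.Propositional using (_∉_)
open import Data.List.Relation.Unary.All using (All)
open import Data.List.Relation.Unary.Unique.Propositional using (Unique)
open import Relation.Binary.PropositionalEquality using (_≡_)
open import Relation.Binary.Definitions using (DecidableEquality)
open import Relation.Nullary using (¬_)
open import Relation.Nullary.Decidable using (⌊_⌋)
open import Function.Bundles using (Bijection; _⤖_)

record Graph : Set₁ where
  field
    V   : Set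
    adj : V → V → Bool

open Graph public

module _ (G : Graph) where

  data Reach (E : V G → V G → Set) : V G → V G → Set where
    here : ∀ {u} → Reach E u u
    step : ∀ {u w v} → E u w → Reach E w v → Reach E u v

  EdgeAvoidingVertices : List (V G) → V G → V G → Set
  EdgeAvoidingVertices S u w = (adj G u w ≡ true) × (w ∉ S)

  ConnectedMinusVertices : List (V G) → Set
  ConnectedMinusVertices S =
    ∀ u v → u ∉ S → v ∉ S → Reach (EdgeAvoidingVertices S) u v

  VertexCut : List (V G) → Set
  VertexCut S = (¬ ConnectedMinusVertices S)
              ⊎ (∀ u v → u ∉ S → v ∉ S → u ≡ v)

  IsVertexConnectivity : ℕ → Set
  IsVertexConnectivity k =
    (∃ λ S → Unique S × length S ≡ k × VertexCut S)
    × (∀ S → Unique S → VertexCut S → k ≤ length S)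

  IsEdgeSet : List (V G × V G) → Set
  IsEdgeSet F = Unique F
              × All (λ p → adj G (proj₁ p) (proj₂ p) ≡ true) F
              × All (λ p → swap p ∉ F) F

  EdgeAvoidingEdges : List (V G × V G) → V G → V G → Set
  EdgeAvoidingEdges F u w = (adj G u w ≡ true) × ((u , w) ∉ F) × ((w , u) ∉ F)

  ConnectedMinusEdges : List (V G × V G) → Set
  ConnectedMinusEdges F = ∀ u v → Reach (EdgeAvoidingEdges F) u v

  IsEdgeConnectivity : ℕ → Set
  IsEdgeConnectivity k =
    (∃ λ F → IsEdgeSet F × length F ≡ k × ¬ ConnectedMinusEdges F)
    × (∀ F → IsEdgeSet F → ¬ ConnectedMinusEdges F → k ≤ length F)

-- Line graph.  An edge {u,v} is represented canonically by the ordered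
-- pair (u , v) with u < v for a given strict total order `lt`.

lineGraph : (G : Graph) → DecidableEquality (V G)
          → (lt : V G → V G → Bool) → Graph
lineGraph G _≟_ lt = record { V = E ; adj = ladj }
  where
    E : Set
    E = Σ (V G × V G) λ p → (lt (proj₁ p) (proj₂ p) ≡ true)
                          × (adj G (proj₁ p) (proj₂ p) ≡ true)
    eq : V G → V G → Bool
    eq x y = ⌊ x ≟ y ⌋
    ladj : E → E → Bool
    ladj ((u , v) , _) ((u' , v') , _) =
      not (eq u u' ∧ eq v v')
      ∧ (eq u u' ∨ eq u v' ∨ eq v u' ∨ eq v v')

-- Hypercube-like networks, with vertex set Vec Bool n (bit strings).
-- Copy 1 of Q_{n-1} lives on strings starting with false, copy 2 on
-- strings starting with true.

BitVec : ℕ → Set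
BitVec n = Vec Bool n

_≟V_ : ∀ {n} → DecidableEquality (BitVec n)
_≟V_ = VecP.≡-dec BoolP._≟_

lexLt : ∀ {n} → BitVec n → BitVec n → Bool
lexLt []           []           = false
lexLt (false ∷ u)  (true  ∷ v)  = true
lexLt (true  ∷ u)  (false ∷ v)  = false
lexLt (false ∷ u)  (false ∷ v)  = lexLt u v
lexLt (true  ∷ u)  (true  ∷ v)  = lexLt u v

K2adj : BitVec 1 → BitVec 1 → Bool
K2adj u v = not ⌊ u ≟V v ⌋

oplus : ∀ {n} → (BitVec n → BitVec n → Bool) → (BitVec n → BitVec n → Bool)
      → (BitVec n → BitVec n) → BitVec (suc n) → BitVec (suc n) → Bool
oplus R1 R2 f (false ∷ u) (false ∷ v) = R1 u v
oplus R1 R2 f (true  ∷ u) (true  ∷ v) = R2 u v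
oplus R1 R2 f (false ∷ u) (true  ∷ v) = ⌊ f u ≟V v ⌋
oplus R1 R2 f (true  ∷ u) (false ∷ v) = ⌊ f v ≟V u ⌋

data IsHL : (n : ℕ) → (BitVec n → BitVec n → Bool) → Set where
  base : IsHL 1 K2adj
  step : ∀ {n R1 R2} → IsHL n R1 → IsHL n R2
       → (f : BitVec n ⤖ BitVec n)
       → IsHL (suc n) (oplus R1 R2 (Bijection.to f))

hlGraph : (n : ℕ) → (BitVec n → BitVec n → Bool) → Graph
hlGraph n R = record { V = BitVec n ; adj = R }

lineHL : (n : ℕ) → (BitVec n → BitVec n → Bool) → Graph
lineHL n R = lineGraph (hlGraph n R) _≟V_ lexLt

{-# OPTIONS --safe #-}

-- An n-dimensional hypercube-like network G = G₁ ⊕_f G₂ is n-regular and triangle-free. By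
-- induction on n, G − F is connected whenever |F| < n, and more strongly, for |F| < 2n − 2 all
-- non-isolated vertices of G − F lie in one component (when |F| < n no vertex is isolated, so
-- the first claim follows from the second). For the second claim, one copy, say G₂, contains
-- fewer than n − 1 edges of F and stays connected. A vertex a of G₁ with a surviving edge to c
-- reaches G₂ in at most three steps: otherwise the cross edges at a and c, and one deleted edge
-- on each route a → d → G₂ (d ∼ a, d ≠ c) and a → c → d → G₂ (d ∼ c, d ≠ a), would be
-- 2 + 2(n − 2) distinct edges of F.
-- The line graph L(G) is (2n − 2)-regular and not complete. Deleting fewer than 2n − 2 vertices
-- of L(G) deletes as many edges of G; the surviving edges are non-isolated, hence joined by
-- walks of G that avoid the deleted edges, which gives κ(L(G)) ≥ 2n − 2. To join a to b in
-- L(G) minus fewer than 2n − 2 edges, delete instead one endpoint other than a, b of each such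
-- edge except a–b, and apply the vertex case (through a neighbour of b if a–b is deleted);
-- so λ(L(G)) ≥ 2n − 2. A neighbourhood, respectively the edges at a vertex, attain both bounds.

module Submission where

open import Defs
open import Data.Nat using (ℕ; suc; _+_; _*_; _∸_; _≤_; _<_; z≤n; s≤s; _<?_; _≤?_)
open import Data.Nat.Properties
open import Data.Bool using (Bool; true; false; not)
open import Data.Vec using ([]; _∷_; replicate)
open import Data.Vec.Properties using (∷-injectiveʳ)
open import Function.Bundles using (Bijection; Surjection; _⤖_)
open import Data.List using (List; []; _∷_; length; map; filter; _++_)
open import Data.List.Properties using (filter-notAll; length-map; length-++; map-∘; map-cong; map-id)
open import Data.List.Membership.Propositional using (_∈_; _∉_; find)
open import Data.List.Membership.Propositional.Properties using (∈-filter⁺; ∈-filter⁻; ∈-map⁺; ∈-map⁻; ∈-++⁺ˡ; ∈-++⁺ʳ; ∈-++⁻)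
import Data.List.Membership.DecPropositional as DecMembership
open import Data.List.Relation.Binary.Subset.Propositional using (_⊆_)
open import Data.List.Relation.Unary.Any as Any using (Any; here; there; any?)
open import Data.List.Relation.Unary.All as All using (All; []; _∷_; all?)
open import Data.List.Relation.Unary.All.Properties as All using (¬All⇒Any¬; ¬Any⇒All¬)
open import Data.List.Relation.Unary.AllPairs as AllPairs using (AllPairs; []; _∷_)
import Data.List.Relation.Unary.AllPairs.Properties as AllPairs
open import Data.List.Relation.Unary.Unique.Propositional using (Unique)
import Data.List.Relation.Unary.Unique.Propositional.Properties as Unique
open import Data.Product using (∃; ∃₂; _×_; _,_; proj₁; proj₂; swap)
open import Data.Product.Properties using (≡-dec; ,-injective; ,-injectiveʳ)
open import Data.Sum using (_⊎_; inj₁; inj₂; [_,_]; [_,_]′) renaming (swap to swap⊎)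
open import Data.Empty using (⊥; ⊥-elim)
open import Function using (_∘_; id)
open import Relation.Binary.PropositionalEquality using (_≡_; _≢_; refl; sym; trans; cong; cong₂; subst; subst₂; module ≡-Reasoning)
open import Relation.Binary.Definitions using (DecidableEquality)
open import Relation.Nullary using (¬_; Dec; yes; no; ¬?; does; _because_; contradiction)
open import Relation.Nullary.Reflects using (Reflects; ofʸ; ofⁿ)
open import Relation.Nullary.Decidable.Core using (isYes)
open import Relation.Nullary.Decidable as Decidable using (_×-dec_; _⊎-dec_; dec-true)
open import Axiom.UniquenessOfIdentityProofs using (module Decidable⇒UIP)
import Data.Bool as Bool

does-true : ∀ {P : Set} (p? : Dec P) → does p? ≡ true → P
does-true (yes p) _ = p

isYes-true : ∀ {P : Set} (p? : Dec P) → isYes p? ≡ true → P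
isYes-true (yes p) _ = p

isYes-≡ : ∀ {P Q : Set} (p? : Dec P) (q? : Dec Q) → (P → Q) → (Q → P) → isYes p? ≡ isYes q?
isYes-≡ (yes _) (yes _) _ _ = refl
isYes-≡ (no _) (no _) _ _ = refl
isYes-≡ (yes p) (no ¬q) p→q _ = contradiction (p→q p) ¬q
isYes-≡ (no ¬p) (yes q) _ q→p = contradiction (q→p q) ¬p

isYes-intro : ∀ {P : Set} (p? : Dec P) → P → isYes p? ≡ true
isYes-intro (yes _) _ = refl
isYes-intro (no ¬p) p = contradiction p ¬p

suc+suc≡2* : ∀ {a b d} → suc a ≡ d → suc b ≡ d → 2 + (a + b) ≡ 2 * d
suc+suc≡2* {a} refl refl = cong suc (begin
  suc (a + a)        ≡⟨ cong (λ z → suc (a + z)) (sym (+-identityʳ a)) ⟩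
  suc (a + (a + 0))  ≡⟨ +-suc a (a + 0) ⟨
  a + suc (a + 0)    ∎)
  where open ≡-Reasoning

pred+pred≡2*∸2 : ∀ {a b d} → suc a ≡ d → suc b ≡ d → a + b ≡ 2 * d ∸ 2
pred+pred≡2*∸2 a+1≡d b+1≡d = cong (_∸ 2) (suc+suc≡2* a+1≡d b+1≡d)

a+b<m+m⇒a<m : ∀ a {b m} → a + b < m + m → m ≤ b → a < m
a+b<m+m⇒a<m a {b} {m} a+b<m+m m≤b = +-cancelʳ-< m a m (≤-<-trans (+-monoʳ-≤ a m≤b) a+b<m+m)

2*≡+ : ∀ m → 2 * m ≡ m + m
2*≡+ m = cong (m +_) (+-identityʳ m)

∃∈-of-length> : ∀ {A : Set} {xs : List A} → 0 < length xs → ∃ λ x → x ∈ xs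
∃∈-of-length> {xs = x ∷ _} _ = x , here refl

module _ {A : Set} (_≟_ : DecidableEquality A) where

  open DecMembership _≟_ using (_∈?_)

  remove : A → List A → List A
  remove x = filter (λ y → ¬? (y ≟ x))

  ∈-remove⁺ : ∀ {x y ys} → y ∈ ys → y ≢ x → y ∈ remove x ys
  ∈-remove⁺ {x} = ∈-filter⁺ (λ y → ¬? (y ≟ x))

  ∈-remove⁻ : ∀ {x y ys} → y ∈ remove x ys → y ∈ ys × y ≢ x
  ∈-remove⁻ {x} = ∈-filter⁻ (λ y → ¬? (y ≟ x))

  length-remove-< : ∀ {x ys} → x ∈ ys → length (remove x ys) < length ys
  length-remove-< {x} {ys} x∈ys =
    filter-notAll (λ y → ¬? (y ≟ x)) ys (Any.map (λ x≡y y≢x → y≢x (sym x≡y)) x∈ys)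

  Unique-remove : ∀ {x ys} → Unique ys → Unique (remove x ys)
  Unique-remove {x} = Unique.filter⁺ (λ y → ¬? (y ≟ x))

  Unique⊆⇒length≤ : ∀ {xs ys} → Unique xs → xs ⊆ ys → length xs ≤ length ys
  Unique⊆⇒length≤ {[]} _ _ = z≤n
  Unique⊆⇒length≤ {x ∷ xs} {ys} (x∉xs ∷ xs!) x∷xs⊆ys = begin
    suc (length xs)             ≤⟨ s≤s (Unique⊆⇒length≤ xs! xs⊆ys−x) ⟩
    suc (length (remove x ys))  ≤⟨ length-remove-< (x∷xs⊆ys (here refl)) ⟩
    length ys                   ∎
    where
    open ≤-Reasoning
    xs⊆ys−x : xs ⊆ remove x ys
    xs⊆ys−x z∈xs = ∈-remove⁺ (x∷xs⊆ys (there z∈xs)) (λ { refl → All.lookup x∉xs z∈xs refl })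

  length-remove-∈ : ∀ {x ys} → Unique ys → x ∈ ys → suc (length (remove x ys)) ≡ length ys
  length-remove-∈ {x} {ys} ys! x∈ys =
    ≤-antisym (length-remove-< x∈ys) (Unique⊆⇒length≤ ys! ys⊆x∷ys−x)
    where
    ys⊆x∷ys−x : ys ⊆ x ∷ remove x ys
    ys⊆x∷ys−x {y} y∈ys with y ≟ x
    ... | yes refl = here refl
    ... | no y≢x = there (∈-remove⁺ y∈ys y≢x)

  ∃∉-of-length< : ∀ {xs ys} → Unique xs → length ys < length xs → ∃ λ z → z ∈ xs × z ∉ ys
  ∃∉-of-length< {xs} {ys} xs! ys<xs with all? (_∈? ys) xs
  ... | yes xs⊆ys = contradiction (Unique⊆⇒length≤ xs! (All.lookup xs⊆ys)) (<⇒≱ ys<xs)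
  ... | no xs⊈ys = find (¬All⇒Any¬ (_∈? ys) xs xs⊈ys)

  ∃₂∉-of-suc-length< : ∀ {xs ys} → Unique xs → suc (length ys) < length xs →
                       ∃₂ λ z z′ → z ∉ ys × z′ ∉ ys × z ≢ z′
  ∃₂∉-of-suc-length< {xs} {ys} xs! ys+1<xs
    with ∃∉-of-length< xs! (<⇒≤ ys+1<xs)
  ... | z , _ , z∉ys with ∃∉-of-length< {ys = z ∷ ys} xs! ys+1<xs
  ... | z′ , _ , z′∉z∷ys = z , z′ , z∉ys , z′∉z∷ys ∘ there , λ { refl → z′∉z∷ys (here refl) }

-- Edges as ordered pairs up to orientation

SameEdge : ∀ {A : Set} → A × A → A × A → Set
SameEdge e e′ = e ≡ e′ ⊎ e ≡ swap e′

SameEdge-sym : ∀ {A : Set} {e e′ : A × A} → SameEdge e e′ → SameEdge e′ e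
SameEdge-sym (inj₁ refl) = inj₁ refl
SameEdge-sym (inj₂ refl) = inj₂ refl

SameEdge-trans : ∀ {A : Set} {e e′ e″ : A × A} → SameEdge e e′ → SameEdge e′ e″ → SameEdge e e″
SameEdge-trans (inj₁ refl) s = s
SameEdge-trans (inj₂ refl) (inj₁ refl) = inj₂ refl
SameEdge-trans (inj₂ refl) (inj₂ refl) = inj₁ refl

Avoids : ∀ {A : Set} → List (A × A) → A × A → Set
Avoids F e = e ∉ F × swap e ∉ F

SameEdge-from⇒≡ : ∀ {A : Set} {x w w′ : A} → SameEdge (x , w) (x , w′) → w ≡ w′
SameEdge-from⇒≡ (inj₁ refl) = refl
SameEdge-from⇒≡ (inj₂ refl) = refl

Avoids-SameEdge : ∀ {A : Set} {F : List (A × A)} {e e′} → SameEdge e e′ → Avoids F e′ → Avoids F e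
Avoids-SameEdge (inj₁ refl) avoids = avoids
Avoids-SameEdge (inj₂ refl) (e∉F , e′∉F) = e′∉F , e∉F

Deleted : ∀ {A : Set} → List (A × A) → A × A → Set
Deleted F e = e ∈ F ⊎ swap e ∈ F

module _ {A : Set} (_≟_ : DecidableEquality A) where

  _≟²_ : DecidableEquality (A × A)
  _≟²_ = ≡-dec _≟_ _≟_

  open DecMembership _≟²_ using (_∈?_; _∉?_)

  avoids? : ∀ F e → Dec (Avoids F e)
  avoids? F e = (e ∉? F) ×-dec (swap e ∉? F)

  avoids-or-deleted : ∀ F e → Avoids F e ⊎ Deleted F e
  avoids-or-deleted F e with e ∈? F | swap e ∈? F
  ... | yes e∈F | _ = inj₂ (inj₁ e∈F)
  ... | no _ | yes e′∈F = inj₂ (inj₂ e′∈F)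
  ... | no e∉F | no e′∉F = inj₁ (e∉F , e′∉F)

  ¬avoids⇒deleted : ∀ {F e} → ¬ Avoids F e → Deleted F e
  ¬avoids⇒deleted {F} {e} ¬avoids with avoids-or-deleted F e
  ... | inj₁ avoids = contradiction avoids ¬avoids
  ... | inj₂ deleted = deleted

  Deleted-remove : ∀ {F e r} → ¬ SameEdge e r → Deleted F e → Deleted (remove _≟²_ r F) e
  Deleted-remove e≁r (inj₁ e∈F) = inj₁ (∈-remove⁺ _≟²_ e∈F (e≁r ∘ inj₁))
  Deleted-remove e≁r (inj₂ e′∈F) = inj₂ (∈-remove⁺ _≟²_ e′∈F (λ { refl → e≁r (inj₂ refl) }))

  private
    representative : ∀ {F : List (A × A)} {e} → Deleted F e → ∃ λ r → r ∈ F × SameEdge e r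
    representative (inj₁ e∈F) = _ , e∈F , inj₁ refl
    representative (inj₂ e′∈F) = _ , e′∈F , inj₂ refl

  distinct-deleted-length≤ : ∀ {es} (F : List (A × A)) → AllPairs (λ e e′ → ¬ SameEdge e e′) es → All (Deleted F) es →
                             length es ≤ length F
  distinct-deleted-length≤ F [] [] = z≤n
  distinct-deleted-length≤ {_ ∷ es} F (e≁es ∷ es-distinct) (e-deleted ∷ es-deleted)
    with representative e-deleted
  ... | r , r∈F , e~r =
    ≤-trans (s≤s (distinct-deleted-length≤ (remove _≟²_ r F) es-distinct es-deleted′))
            (length-remove-< _≟²_ r∈F)
    where
    es-deleted′ : All (Deleted (remove _≟²_ r F)) es
    es-deleted′ = All.zipWith
      (λ (e≁e′ , e′-deleted) →
         Deleted-remove (λ e′~r → e≁e′ (SameEdge-trans e~r (SameEdge-sym e′~r))) e′-deleted)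
      (e≁es , es-deleted)

module _ {G : Graph} {E : V G → V G → Set} where

  infixr 5 _◅◅_
  _◅◅_ : ∀ {u w v} → Reach G E u w → Reach G E w v → Reach G E u v
  here ◅◅ q = q
  step e p ◅◅ q = step e (p ◅◅ q)

  reverse : (∀ {u w} → E u w → E w u) → ∀ {u v} → Reach G E u v → Reach G E v u
  reverse sym here = here
  reverse sym (step e p) = reverse sym p ◅◅ step (sym e) here

  ¬Reach-isolated : ∀ {u v} → u ≢ v → (∀ {w} → ¬ E u w) → ¬ Reach G E u v
  ¬Reach-isolated u≢v _ here = u≢v refl
  ¬Reach-isolated _ isolated (step e _) = isolated e

module _ (G : Graph) where

  ReachMinusEdges : List (V G × V G) → V G → V G → Set
  ReachMinusEdges F = Reach G (EdgeAvoidingEdges G F)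

  NonIsolatedMinusEdges : List (V G × V G) → V G → Set
  NonIsolatedMinusEdges F u = ∃ λ w → EdgeAvoidingEdges G F u w

  EdgeConnected : ℕ → Set
  EdgeConnected k = ∀ F → length F < k → ConnectedMinusEdges G F

  VertexConnected : ℕ → Set
  VertexConnected k = ∀ S → length S < k → ConnectedMinusVertices G S

  NonIsolatedConnected : ℕ → Set
  NonIsolatedConnected k = ∀ F → length F < k → ∀ u v →
    NonIsolatedMinusEdges F u → NonIsolatedMinusEdges F v → ReachMinusEdges F u v

  NonComplete : Set
  NonComplete = ∃₂ λ x y → x ≢ y × adj G x y ≢ true

  TriangleFree : Set
  TriangleFree = ∀ {x y z} → adj G x y ≡ true → adj G y z ≡ true → adj G x z ≡ true → ⊥

  record SimpleRegular (d : ℕ) : Set where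
    field
      adj-sym            : ∀ {x y} → adj G x y ≡ true → adj G y x ≡ true
      adj-irrefl         : ∀ {x} → adj G x x ≢ true
      neighbours         : V G → List (V G)
      ∈-neighbours⁺      : ∀ {x y} → adj G x y ≡ true → y ∈ neighbours x
      ∈-neighbours⁻      : ∀ {x y} → y ∈ neighbours x → adj G x y ≡ true
      neighbours-unique  : ∀ x → Unique (neighbours x)
      length-neighbours  : ∀ x → length (neighbours x) ≡ d

    adj⇒≢ : ∀ {x y} → adj G x y ≡ true → x ≢ y
    adj⇒≢ xy refl = adj-irrefl xy

module SimpleRegularProperties {G : Graph} (_≟_ : DecidableEquality (V G)) {d} (reg : SimpleRegular G d) where
  open SimpleRegular reg

  neighboursExcept : V G → V G → List (V G)
  neighboursExcept x y = remove _≟_ y (neighbours x)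

  ∈-neighboursExcept⁺ : ∀ x y {w} → adj G x w ≡ true → w ≢ y → w ∈ neighboursExcept x y
  ∈-neighboursExcept⁺ x y xw w≢y = ∈-remove⁺ _≟_ (∈-neighbours⁺ xw) w≢y

  ∈-neighboursExcept⁻ : ∀ x y {w} → w ∈ neighboursExcept x y → adj G x w ≡ true × w ≢ y
  ∈-neighboursExcept⁻ x y w∈ with ∈-remove⁻ _≟_ {ys = neighbours x} w∈
  ... | w∈N , w≢y = ∈-neighbours⁻ w∈N , w≢y

  Unique-neighboursExcept : ∀ x y → Unique (neighboursExcept x y)
  Unique-neighboursExcept x y = Unique-remove _≟_ (neighbours-unique x)

  length-neighboursExcept : ∀ {x y} → adj G x y ≡ true → suc (length (neighboursExcept x y)) ≡ d
  length-neighboursExcept {x} xy =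
    trans (length-remove-∈ _≟_ (neighbours-unique x) (∈-neighbours⁺ xy)) (length-neighbours x)

  nonIsolated-of-length< : ∀ {F} → length F < d → ∀ x → NonIsolatedMinusEdges G F x
  nonIsolated-of-length< {F} F<d x with any? (λ w → avoids? _≟_ F (x , w)) (neighbours x)
  ... | yes some with find some
  ...   | w , w∈ , avoids = w , ∈-neighbours⁻ w∈ , avoids
  nonIsolated-of-length< {F} F<d x | no none = contradiction (begin
    d                              ≡⟨ sym (length-neighbours x) ⟩
    length (neighbours x)          ≡⟨ sym (length-map (x ,_) (neighbours x)) ⟩
    length (map (x ,_) (neighbours x)) ≤⟨ distinct-deleted-length≤ _≟_ F distinct deleted ⟩
    length F                       ∎) (<⇒≱ F<d)
    where
    open ≤-Reasoning
    distinct : AllPairs (λ e e′ → ¬ SameEdge e e′) (map (x ,_) (neighbours x))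
    distinct = AllPairs.map⁺ (AllPairs.map (λ w≢w′ → w≢w′ ∘ SameEdge-from⇒≡) (neighbours-unique x))
    deleted : All (Deleted F) (map (x ,_) (neighbours x))
    deleted = All.map⁺ (All.map (¬avoids⇒deleted _≟_) (¬Any⇒All¬ _ none))

-- Connectivity of regular graphs

module RegularConnectivity {H : Graph} (_≟_ : DecidableEquality (V H)) {K : ℕ}
                           (reg : SimpleRegular H K) where
  open SimpleRegular reg
  open SimpleRegularProperties _≟_ reg
  open DecMembership _≟_ using (_∈?_)

  ∉-neighbours-self : ∀ x → x ∉ neighbours x
  ∉-neighbours-self x x∈ = adj-irrefl (∈-neighbours⁻ x∈)

  Unique-closedNeighbourhood : ∀ x → Unique (x ∷ neighbours x)
  Unique-closedNeighbourhood x =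
    All.tabulate (λ { w∈ refl → ∉-neighbours-self x w∈ }) ∷ neighbours-unique x

  neighbours-vertexCut : ∀ {e e′} → e ≢ e′ → adj H e e′ ≢ true → VertexCut H (neighbours e)
  neighbours-vertexCut {e} e≢e′ ¬ee′ = inj₁ λ connected →
    ¬Reach-isolated e≢e′ (λ (ew , w∉) → w∉ (∈-neighbours⁺ ew))
      (connected _ _ (∉-neighbours-self e) (¬ee′ ∘ ∈-neighbours⁻))

  vertexCut-length≥ : V H → VertexConnected H K → ∀ S → VertexCut H S → K ≤ length S
  vertexCut-length≥ e κ S cut with K ≤? length S
  ... | yes K≤S = K≤S
  ... | no K≰S with cut
  ...   | inj₁ disconnected = contradiction (κ S (≰⇒> K≰S)) disconnected
  ...   | inj₂ trivial with ∃₂∉-of-suc-length< _≟_ (Unique-closedNeighbourhood e) S+1<K+1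
    where
    S+1<K+1 : suc (length S) < length (e ∷ neighbours e)
    S+1<K+1 = s≤s (subst (length S <_) (sym (length-neighbours e)) (≰⇒> K≰S))
  ...   | z , z′ , z∉S , z′∉S , z≢z′ = contradiction (trivial z z′ z∉S z′∉S) z≢z′

  edgesAt : V H → List (V H × V H)
  edgesAt e = map (e ,_) (neighbours e)

  IsEdgeSet-edgesAt : ∀ e → IsEdgeSet H (edgesAt e)
  IsEdgeSet-edgesAt e =
    Unique.map⁺ (λ eq → ,-injectiveʳ eq) (neighbours-unique e) ,
    All.map⁺ (All.tabulate ∈-neighbours⁻) ,
    All.map⁺ (All.tabulate λ w∈ we∈ → ∉-neighbours-self e (subst (_∈ neighbours e) (back we∈) w∈))
    where
    back : ∀ {w} → (w , e) ∈ edgesAt e → w ≡ e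
    back we∈ with ∈-map⁻ (e ,_) we∈
    ... | _ , _ , refl = refl

  edgesAt-disconnects : ∀ {e e′} → e ≢ e′ → ¬ ConnectedMinusEdges H (edgesAt e)
  edgesAt-disconnects {e} e≢e′ connected =
    ¬Reach-isolated e≢e′ (λ (ew , ew∉ , _) → ew∉ (∈-map⁺ (e ,_) (∈-neighbours⁺ ew))) (connected e _)

  reachMinusEdges-of-reachMinusVertices :
    ∀ {T F} → (∀ {x w} → x ∉ T → w ∉ T → adj H x w ≡ true → Avoids F (x , w)) →
    ∀ {x y} → x ∉ T → Reach H (EdgeAvoidingVertices H T) x y → ReachMinusEdges H F x y
  reachMinusEdges-of-reachMinusVertices avoids x∉T here = here
  reachMinusEdges-of-reachMinusVertices avoids x∉T (step (xw , w∉T) p) =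
    step (xw , avoids x∉T w∉T xw) (reachMinusEdges-of-reachMinusVertices avoids w∉T p)

  -- A set of vertices other than a and b meeting every edge of F except a–b.
  module Cover (a b : V H) where

    ends : List (V H)
    ends = a ∷ b ∷ []

    cover : List (V H × V H) → List (V H)
    cover [] = []
    cover ((p , q) ∷ F) with p ∈? ends | q ∈? ends
    ... | no _  | _     = p ∷ cover F
    ... | yes _ | no _  = q ∷ cover F
    ... | yes _ | yes _ = cover F

    ∉-cover : ∀ {x} F → x ∈ ends → x ∉ cover F
    ∉-cover ((p , q) ∷ F) x∈ends x∈cover with p ∈? ends | q ∈? ends | x∈cover
    ... | no p∉ends | _ | here refl = p∉ends x∈ends
    ... | no _ | _ | there x∈ = ∉-cover F x∈ends x∈
    ... | yes _ | no q∉ends | here refl = q∉ends x∈ends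
    ... | yes _ | no _ | there x∈ = ∉-cover F x∈ends x∈
    ... | yes _ | yes _ | x∈ = ∉-cover F x∈ends x∈

    cover-avoids : ∀ {F p q} → p ∉ ends ⊎ q ∉ ends → p ∉ cover F → q ∉ cover F → (p , q) ∉ F
    cover-avoids {(p′ , q′) ∷ F} outside p∉ q∉ pq∈F with p′ ∈? ends | q′ ∈? ends | pq∈F
    ... | no _ | _ | here refl = p∉ (here refl)
    ... | yes _ | no _ | here refl = q∉ (here refl)
    ... | yes p∈ | yes q∈ | here refl = [ (λ p∉ends → p∉ends p∈) , (λ q∉ends → q∉ends q∈) ] outside
    ... | no _ | _ | there pq∈ = cover-avoids outside (p∉ ∘ there) (q∉ ∘ there) pq∈
    ... | yes _ | no _ | there pq∈ = cover-avoids outside (p∉ ∘ there) (q∉ ∘ there) pq∈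
    ... | yes _ | yes _ | there pq∈ = cover-avoids outside p∉ q∉ pq∈

    length-cover-≤ : ∀ F → length (cover F) ≤ length F
    length-cover-≤ [] = z≤n
    length-cover-≤ ((p , q) ∷ F) with p ∈? ends | q ∈? ends
    ... | no _  | _     = s≤s (length-cover-≤ F)
    ... | yes _ | no _  = s≤s (length-cover-≤ F)
    ... | yes _ | yes _ = m≤n⇒m≤1+n (length-cover-≤ F)

    length-cover-< : ∀ {F p q} → (p , q) ∈ F → p ∈ ends → q ∈ ends → length (cover F) < length F
    length-cover-< {(p′ , q′) ∷ F} pq∈F p∈ q∈ with p′ ∈? ends | q′ ∈? ends | pq∈F
    ... | no p∉ | _ | here refl = contradiction p∈ p∉
    ... | yes _ | no q∉ | here refl = contradiction q∈ q∉
    ... | yes _ | yes _ | here refl = s≤s (length-cover-≤ F)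
    ... | no _ | _ | there pq∈ = s≤s (length-cover-< pq∈ p∈ q∈)
    ... | yes _ | no _ | there pq∈ = s≤s (length-cover-< pq∈ p∈ q∈)
    ... | yes _ | yes _ | there pq∈ = m≤n⇒m≤1+n (length-cover-< pq∈ p∈ q∈)

    ends-SameEdge : ∀ {x w} → x ≢ w → x ∈ ends → w ∈ ends → SameEdge (x , w) (a , b)
    ends-SameEdge x≢w (here refl) (here refl) = contradiction refl x≢w
    ends-SameEdge x≢w (here refl) (there (here refl)) = inj₁ refl
    ends-SameEdge x≢w (there (here refl)) (here refl) = inj₂ refl
    ends-SameEdge x≢w (there (here refl)) (there (here refl)) = contradiction refl x≢w

    avoids-outside : ∀ {F x w} → x ∉ cover F → w ∉ cover F → x ∉ ends ⊎ w ∉ ends → Avoids F (x , w)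
    avoids-outside x∉ w∉ outside = cover-avoids outside x∉ w∉ , cover-avoids (swap⊎ outside) w∉ x∉

  module _ (κ : VertexConnected H K) {F : List (V H × V H)} (F-edges : All (λ (p , q) → adj H p q ≡ true) F)
           (F<K : length F < K) where

    reach-if-avoided : ∀ {a b} → Avoids F (a , b) → ReachMinusEdges H F a b
    reach-if-avoided {a} {b} ab-avoided =
      reachMinusEdges-of-reachMinusVertices avoids a∉cover
        (κ (cover F) (≤-<-trans (length-cover-≤ F) F<K) a b a∉cover (∉-cover F (there (here refl))))
      where
      open Cover a b
      a∉cover : a ∉ cover F
      a∉cover = ∉-cover F (here refl)
      avoids : ∀ {x w} → x ∉ cover F → w ∉ cover F → adj H x w ≡ true → Avoids F (x , w)
      avoids {x} {w} x∉ w∉ xw with x ∈? ends | w ∈? ends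
      ... | yes x∈ | yes w∈ = Avoids-SameEdge (ends-SameEdge (adj⇒≢ xw) x∈ w∈) ab-avoided
      ... | no x∉ends | _ = avoids-outside x∉ w∉ (inj₁ x∉ends)
      ... | yes _ | no w∉ends = avoids-outside x∉ w∉ (inj₂ w∉ends)

    -- If a–b itself is deleted, the cover is smaller than F, so some neighbour w ≠ a of b
    -- escapes it; route a to w avoiding b and the cover, then step to b.
    module _ {a b} (ab-deleted : Deleted F (a , b)) where
      open Cover a b

      private
        ab : adj H a b ≡ true
        ab = [ All.lookup F-edges , adj-sym ∘ All.lookup F-edges ]′ ab-deleted

        cover<F : length (cover F) < length F
        cover<F = [ (λ ab∈ → length-cover-< ab∈ (here refl) (there (here refl)))
                  , (λ ba∈ → length-cover-< ba∈ (there (here refl)) (here refl)) ]′ ab-deleted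

        cover<N∖a : length (cover F) < length (neighboursExcept b a)
        cover<N∖a = ≤-pred (begin-strict
          suc (length (cover F))                  <⟨ s≤s cover<F ⟩
          suc (length F)                          ≤⟨ F<K ⟩
          K                                       ≡⟨ sym (length-neighboursExcept (adj-sym ab)) ⟩
          suc (length (neighboursExcept b a))     ∎)
          where open ≤-Reasoning

      reach-if-deleted : ReachMinusEdges H F a b
      reach-if-deleted
        with ∃∉-of-length< _≟_ {ys = cover F} (Unique-neighboursExcept b a) cover<N∖a
      ... | w , w∈N∖a , w∉cover =
        reachMinusEdges-of-reachMinusVertices avoids a∉T (κ T T<K a w a∉T w∉T)
          ◅◅ step (adj-sym bw , avoids-outside w∉cover b∉cover (inj₁ w∉ends)) here
        where
        T : List (V H)
        T = b ∷ cover F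
        T<K : length T < K
        T<K = ≤-<-trans cover<F F<K
        bw : adj H b w ≡ true
        bw = proj₁ (∈-neighboursExcept⁻ b a w∈N∖a)
        w∉ends : w ∉ ends
        w∉ends (here refl) = proj₂ (∈-neighboursExcept⁻ b a w∈N∖a) refl
        w∉ends (there (here refl)) = adj⇒≢ bw refl
        b∉cover : b ∉ cover F
        b∉cover = ∉-cover F (there (here refl))
        a∉T : a ∉ T
        a∉T (here refl) = adj⇒≢ ab refl
        a∉T (there a∈) = ∉-cover F (here refl) a∈
        w∉T : w ∉ T
        w∉T (here refl) = adj⇒≢ bw refl
        w∉T (there w∈) = w∉cover w∈
        avoids : ∀ {x y} → x ∉ T → y ∉ T → adj H x y ≡ true → Avoids F (x , y)
        avoids {x} {y} x∉T y∉T xy with x ∈? ends | y ∈? ends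
        ... | no x∉ends | _ = avoids-outside (x∉T ∘ there) (y∉T ∘ there) (inj₁ x∉ends)
        ... | yes _ | no y∉ends = avoids-outside (x∉T ∘ there) (y∉T ∘ there) (inj₂ y∉ends)
        ... | yes x∈ | yes y∈ with ends-SameEdge (adj⇒≢ xy) x∈ y∈
        ...   | inj₁ refl = contradiction (here refl) y∉T
        ...   | inj₂ refl = contradiction (here refl) x∉T

    connectedMinusEdges : ConnectedMinusEdges H F
    connectedMinusEdges a b =
      [ reach-if-avoided , reach-if-deleted ]′ (avoids-or-deleted _≟_ F (a , b))

  edgeCut-length≥ : VertexConnected H K → ∀ F → IsEdgeSet H F → ¬ ConnectedMinusEdges H F → K ≤ length F
  edgeCut-length≥ κ F (_ , F-edges , _) disconnected with K ≤? length F
  ... | yes K≤F = K≤F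
  ... | no K≰F = contradiction (connectedMinusEdges κ F-edges (≰⇒> K≰F)) disconnected

  isVertexConnectivity : NonComplete H → VertexConnected H K → IsVertexConnectivity H K
  isVertexConnectivity (e , e′ , e≢e′ , ¬ee′) κ =
    (neighbours e , neighbours-unique e , length-neighbours e , neighbours-vertexCut e≢e′ ¬ee′) ,
    λ S _ → vertexCut-length≥ e κ S

  isEdgeConnectivity : NonComplete H → VertexConnected H K → IsEdgeConnectivity H K
  isEdgeConnectivity (e , e′ , e≢e′ , _) κ =
    (edgesAt e , IsEdgeSet-edgesAt e , trans (length-map _ (neighbours e)) (length-neighbours e) ,
     edgesAt-disconnects e≢e′) ,
    edgeCut-length≥ κ

-- Line graphs

module LineGraph (G : Graph) (_≟_ : DecidableEquality (V G)) (lt : V G → V G → Bool)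
                 (lt-asym : ∀ {x y} → lt x y ≡ true → lt y x ≡ true → ⊥)
                 (lt-connex : ∀ {x y} → x ≢ y → lt x y ≡ true ⊎ lt y x ≡ true) where

  L : Graph
  L = lineGraph G _≟_ lt

  Edge : Set
  Edge = V L

  ends : Edge → V G × V G
  ends = proj₁

  ends-injective : ∀ {t t′ : Edge} → ends t ≡ ends t′ → t ≡ t′
  ends-injective {_ , lt₁ , adj₁} {_ , lt₂ , adj₂} refl =
    cong₂ (λ p q → _ , p , q) (≡-irrelevantᵇ lt₁ lt₂) (≡-irrelevantᵇ adj₁ adj₂)
    where open Decidable⇒UIP Bool._≟_ renaming (≡-irrelevant to ≡-irrelevantᵇ)

  SameEdge⇒≡ : ∀ {t t′ : Edge} → SameEdge (ends t) (ends t′) → t ≡ t′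
  SameEdge⇒≡ (inj₁ eq) = ends-injective eq
  SameEdge⇒≡ {_ , lt₁ , _} {_ , lt₂ , _} (inj₂ refl) = ⊥-elim (lt-asym lt₁ lt₂)

  _≟ᴱ_ : DecidableEquality Edge
  t ≟ᴱ t′ = Decidable.map′ ends-injective (cong ends) ((_≟²_ _≟_) (ends t) (ends t′))

  Incident : V G → Edge → Set
  Incident x t = x ≡ proj₁ (ends t) ⊎ x ≡ proj₂ (ends t)

  SharesEnd : Edge → Edge → Set
  SharesEnd t t′ = ∃ λ x → Incident x t × Incident x t′

  -- The equality tests of lineGraph use ⌊_⌋ = isYes; repackaged as decisions whose boolean is
  -- isYes, they make adj L t t′ definitionally the boolean of a decision procedure.
  private
    _≟ʸ_ : (x y : V G) → Dec (x ≡ y)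
    x ≟ʸ y = isYes (x ≟ y) because reflects (x ≟ y)
      where
      reflects : ∀ {P : Set} (p? : Dec P) → Reflects P (isYes p?)
      reflects (yes p) = ofʸ p
      reflects (no ¬p) = ofⁿ ¬p

    adjacent? : ∀ (t t′ : Edge) → Dec (t ≢ t′ × SharesEnd t t′)
    adjacent? t@((u , v) , _) t′@((u′ , v′) , _) =
      Decidable.map′ (λ (≢ends , shared) → (λ t≡t′ → ≢ends (,-injective (cong ends t≡t′))) , sharedEnd shared)
               (λ (t≢t′ , x , x∈t , x∈t′) →
                  (λ (u≡u′ , v≡v′) → t≢t′ (ends-injective (cong₂ _,_ u≡u′ v≡v′))) , endEqualities x∈t x∈t′)
        (¬? ((u ≟ʸ u′) ×-dec (v ≟ʸ v′))
         ×-dec ((u ≟ʸ u′) ⊎-dec (u ≟ʸ v′) ⊎-dec (v ≟ʸ u′) ⊎-dec (v ≟ʸ v′)))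
      where
      sharedEnd : u ≡ u′ ⊎ u ≡ v′ ⊎ v ≡ u′ ⊎ v ≡ v′ → SharesEnd t t′
      sharedEnd (inj₁ uu′) = u , inj₁ refl , inj₁ uu′
      sharedEnd (inj₂ (inj₁ uv′)) = u , inj₁ refl , inj₂ uv′
      sharedEnd (inj₂ (inj₂ (inj₁ vu′))) = v , inj₂ refl , inj₁ vu′
      sharedEnd (inj₂ (inj₂ (inj₂ vv′))) = v , inj₂ refl , inj₂ vv′
      endEqualities : ∀ {x} → Incident x t → Incident x t′ → u ≡ u′ ⊎ u ≡ v′ ⊎ v ≡ u′ ⊎ v ≡ v′
      endEqualities (inj₁ refl) (inj₁ refl) = inj₁ refl
      endEqualities (inj₁ refl) (inj₂ refl) = inj₂ (inj₁ refl)
      endEqualities (inj₂ refl) (inj₁ refl) = inj₂ (inj₂ (inj₁ refl))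
      endEqualities (inj₂ refl) (inj₂ refl) = inj₂ (inj₂ (inj₂ refl))

  adj-line⁻ : ∀ {t t′} → adj L t t′ ≡ true → t ≢ t′ × SharesEnd t t′
  adj-line⁻ {t} {t′} = does-true (adjacent? t t′)

  adj-line⁺ : ∀ {t t′ x} → t ≢ t′ → Incident x t → Incident x t′ → adj L t t′ ≡ true
  adj-line⁺ {t} {t′} t≢t′ x∈t x∈t′ = dec-true (adjacent? t t′) (t≢t′ , _ , x∈t , x∈t′)

  SameEdge⇒Incident : ∀ {t x y} → SameEdge (ends t) (x , y) → Incident x t × Incident y t
  SameEdge⇒Incident (inj₁ refl) = inj₁ refl , inj₂ refl
  SameEdge⇒Incident (inj₂ refl) = inj₂ refl , inj₁ refl

  Incident-SameEdge : ∀ {t x y z} → SameEdge (ends t) (x , y) → Incident z t → z ≡ x ⊎ z ≡ y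
  Incident-SameEdge (inj₁ refl) z∈t = z∈t
  Incident-SameEdge (inj₂ refl) z∈t = swap⊎ z∈t

  Incident⇒SameEdge : ∀ {t x} → Incident x t → ∃ λ y → SameEdge (ends t) (x , y)
  Incident⇒SameEdge (inj₁ refl) = _ , inj₁ refl
  Incident⇒SameEdge (inj₂ refl) = _ , inj₂ refl

  module _ {d} (reg : SimpleRegular G d) where
    open SimpleRegular reg
    open SimpleRegularProperties _≟_ reg

    SameEdge⇒adj : ∀ {t x y} → SameEdge (ends t) (x , y) → adj G x y ≡ true
    SameEdge⇒adj {_ , _ , uv} (inj₁ refl) = uv
    SameEdge⇒adj {_ , _ , uv} (inj₂ refl) = adj-sym uv

    private
      orientedEdge : ∀ {x y} → adj G x y ≡ true → lt x y ≡ true ⊎ lt y x ≡ true → Edge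
      orientedEdge {x} {y} xy (inj₁ x<y) = (x , y) , x<y , xy
      orientedEdge {x} {y} xy (inj₂ y<x) = (y , x) , y<x , adj-sym xy

      orientedEdge-ends : ∀ {x y} (xy : adj G x y ≡ true) o → SameEdge (ends (orientedEdge xy o)) (x , y)
      orientedEdge-ends xy (inj₁ _) = inj₁ refl
      orientedEdge-ends xy (inj₂ _) = inj₂ refl

    edge : ∀ {x y} → adj G x y ≡ true → Edge
    edge xy = orientedEdge xy (lt-connex (adj⇒≢ xy))

    edge-ends : ∀ {x y} (xy : adj G x y ≡ true) → SameEdge (ends (edge xy)) (x , y)
    edge-ends xy = orientedEdge-ends xy (lt-connex (adj⇒≢ xy))

    AdjacentToAll : V G → List (V G) → Set
    AdjacentToAll x ws = ∀ {w} → w ∈ ws → adj G x w ≡ true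

    edgesFrom : ∀ x ws → AdjacentToAll x ws → List Edge
    edgesFrom x [] _ = []
    edgesFrom x (w ∷ ws) xws = edge (xws (here refl)) ∷ edgesFrom x ws (xws ∘ there)

    ∈-edgesFrom⁻ : ∀ x ws {xws : AdjacentToAll x ws} {t} → t ∈ edgesFrom x ws xws →
                   ∃ λ w → w ∈ ws × SameEdge (ends t) (x , w)
    ∈-edgesFrom⁻ x (w ∷ _) {xws} (here refl) = w , here refl , edge-ends (xws (here refl))
    ∈-edgesFrom⁻ x (_ ∷ ws) (there t∈) with ∈-edgesFrom⁻ x ws t∈
    ... | w , w∈ , t~xw = w , there w∈ , t~xw

    ∈-edgesFrom⁺ : ∀ x ws {xws : AdjacentToAll x ws} {w t} → w ∈ ws → SameEdge (ends t) (x , w) →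
                   t ∈ edgesFrom x ws xws
    ∈-edgesFrom⁺ x (_ ∷ _) {xws} (here refl) t~xw =
      here (SameEdge⇒≡ (SameEdge-trans t~xw (SameEdge-sym (edge-ends (xws (here refl))))))
    ∈-edgesFrom⁺ x (_ ∷ ws) (there w∈) t~xw = there (∈-edgesFrom⁺ x ws w∈ t~xw)

    length-edgesFrom : ∀ x ws (xws : AdjacentToAll x ws) → length (edgesFrom x ws xws) ≡ length ws
    length-edgesFrom x [] _ = refl
    length-edgesFrom x (_ ∷ ws) xws = cong suc (length-edgesFrom x ws (xws ∘ there))

    Unique-edgesFrom : ∀ x ws (xws : AdjacentToAll x ws) → Unique ws → Unique (edgesFrom x ws xws)
    Unique-edgesFrom x [] _ [] = []
    Unique-edgesFrom x (w ∷ ws) xws (w∉ws ∷ ws!) =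
      All.tabulate distinct ∷ Unique-edgesFrom x ws (xws ∘ there) ws!
      where
      distinct : ∀ {t} → t ∈ edgesFrom x ws (xws ∘ there) → edge (xws (here refl)) ≢ t
      distinct t∈ refl with ∈-edgesFrom⁻ x ws t∈
      ... | w′ , w′∈ , t~xw′ = All.lookup w∉ws w′∈
        (SameEdge-from⇒≡ (SameEdge-trans (SameEdge-sym (edge-ends (xws (here refl)))) t~xw′))

    otherEdgesAt : V G → V G → List Edge
    otherEdgesAt x y = edgesFrom x (neighboursExcept x y) (proj₁ ∘ ∈-neighboursExcept⁻ x y)

    ∈-otherEdgesAt⁻ : ∀ x y {t} → t ∈ otherEdgesAt x y → ∃ λ w → w ≢ y × SameEdge (ends t) (x , w)
    ∈-otherEdgesAt⁻ x y t∈ with ∈-edgesFrom⁻ x (neighboursExcept x y) t∈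
    ... | w , w∈ , t~xw = w , proj₂ (∈-neighboursExcept⁻ x y w∈) , t~xw

    ∈-otherEdgesAt⁺ : ∀ x y {w t} → w ≢ y → SameEdge (ends t) (x , w) → t ∈ otherEdgesAt x y
    ∈-otherEdgesAt⁺ x y {t = t} w≢y t~xw =
      ∈-edgesFrom⁺ x (neighboursExcept x y) (∈-neighboursExcept⁺ x y (SameEdge⇒adj {t} t~xw) w≢y) t~xw

    lineNeighbours : Edge → List Edge
    lineNeighbours ((u , v) , _) = otherEdgesAt u v ++ otherEdgesAt v u

    ∈-lineNeighbours⁻ : ∀ {t t′} → t′ ∈ lineNeighbours t → adj L t t′ ≡ true
    ∈-lineNeighbours⁻ {t@((u , v) , _ , uv)} {t′} t′∈ with ∈-++⁻ (otherEdgesAt u v) t′∈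
    ... | inj₁ t′∈₁ with ∈-otherEdgesAt⁻ u v t′∈₁
    ...   | w , w≢v , t′~uw = adj-line⁺ t≢t′ (inj₁ refl) (proj₁ (SameEdge⇒Incident {t′} t′~uw))
      where
      t≢t′ : t ≢ t′
      t≢t′ refl = w≢v (sym (SameEdge-from⇒≡ t′~uw))
    ∈-lineNeighbours⁻ {t@((u , v) , _ , uv)} {t′} t′∈ | inj₂ t′∈₂ with ∈-otherEdgesAt⁻ v u t′∈₂
    ...   | w , w≢u , t′~vw = adj-line⁺ t≢t′ (inj₂ refl) (proj₁ (SameEdge⇒Incident {t′} t′~vw))
      where
      t≢t′ : t ≢ t′
      t≢t′ refl = [ (λ eq → adj⇒≢ uv (proj₁ (,-injective eq)))
                  , (λ eq → w≢u (sym (proj₁ (,-injective eq)))) ]′ t′~vw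

    ∈-lineNeighbours⁺ : ∀ {t t′} → adj L t t′ ≡ true → t′ ∈ lineNeighbours t
    ∈-lineNeighbours⁺ {t@((u , v) , _)} {t′} tt′ with adj-line⁻ {t} {t′} tt′
    ... | t≢t′ , x , x∈t , x∈t′ with Incident⇒SameEdge {t′} x∈t′ | x∈t
    ...   | w , t′~xw | inj₁ refl = ∈-++⁺ˡ (∈-otherEdgesAt⁺ u v w≢v t′~xw)
      where
      w≢v : w ≢ v
      w≢v refl = t≢t′ (SameEdge⇒≡ (SameEdge-sym t′~xw))
    ...   | w , t′~xw | inj₂ refl = ∈-++⁺ʳ (otherEdgesAt u v) (∈-otherEdgesAt⁺ v u w≢u t′~xw)
      where
      w≢u : w ≢ u
      w≢u refl = t≢t′ (SameEdge⇒≡ (SameEdge-sym (SameEdge-trans t′~xw (inj₂ refl))))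

    Unique-lineNeighbours : ∀ t → Unique (lineNeighbours t)
    Unique-lineNeighbours ((u , v) , _ , uv) =
      Unique.++⁺ (Unique-edgesFrom u (neighboursExcept u v) _ (Unique-neighboursExcept u v))
                 (Unique-edgesFrom v (neighboursExcept v u) _ (Unique-neighboursExcept v u)) disjoint
      where
      disjoint : ∀ {t′} → ¬ (t′ ∈ otherEdgesAt u v × t′ ∈ otherEdgesAt v u)
      disjoint (t′∈₁ , t′∈₂) with ∈-otherEdgesAt⁻ u v t′∈₁ | ∈-otherEdgesAt⁻ v u t′∈₂
      ... | w , w≢v , t′~uw | _ , _ , t′~vw′ with SameEdge-trans (SameEdge-sym t′~uw) t′~vw′
      ...   | inj₁ refl = adj-irrefl uv
      ...   | inj₂ refl = w≢v refl

    length-lineNeighbours : ∀ t → length (lineNeighbours t) ≡ 2 * d ∸ 2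
    length-lineNeighbours ((u , v) , _ , uv) = begin
      length (otherEdgesAt u v ++ otherEdgesAt v u)
        ≡⟨ length-++ (otherEdgesAt u v) ⟩
      length (otherEdgesAt u v) + length (otherEdgesAt v u)
        ≡⟨ cong₂ _+_ (length-edgesFrom u (neighboursExcept u v) _)
                     (length-edgesFrom v (neighboursExcept v u) _) ⟩
      length (neighboursExcept u v) + length (neighboursExcept v u)
        ≡⟨ pred+pred≡2*∸2 (length-neighboursExcept uv) (length-neighboursExcept (adj-sym uv)) ⟩
      2 * d ∸ 2 ∎
      where open ≡-Reasoning

    simpleRegular-line : SimpleRegular L (2 * d ∸ 2)
    simpleRegular-line = record
      { adj-sym           = λ {t} {t′} tt′ → let t≢t′ , _ , x∈t , x∈t′ = adj-line⁻ {t} {t′} tt′ in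
                                             adj-line⁺ (t≢t′ ∘ sym) x∈t′ x∈t
      ; adj-irrefl        = λ {t} tt → proj₁ (adj-line⁻ {t} {t} tt) refl
      ; neighbours        = lineNeighbours
      ; ∈-neighbours⁺     = λ {t} {t′} → ∈-lineNeighbours⁺ {t} {t′}
      ; ∈-neighbours⁻     = λ {t} {t′} → ∈-lineNeighbours⁻ {t} {t′}
      ; neighbours-unique = Unique-lineNeighbours
      ; length-neighbours = length-lineNeighbours
      }

    private
      Deleted-ends⇒∈ : ∀ {S t} → Deleted (map ends S) (ends t) → t ∈ S
      Deleted-ends⇒∈ {S} {t} (inj₁ t∈) with ∈-map⁻ ends t∈
      ... | s , s∈S , eq = subst (_∈ S) (sym (ends-injective {t} {s} eq)) s∈S
      Deleted-ends⇒∈ {S} {t} (inj₂ t′∈) with ∈-map⁻ ends t′∈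
      ... | s , s∈S , eq = subst (_∈ S) (sym (SameEdge⇒≡ {t} {s} (inj₂ (cong swap eq)))) s∈S

      edge∉ : ∀ {S x y} (xy : adj G x y ≡ true) → Avoids (map ends S) (x , y) → edge xy ∉ S
      edge∉ {S} xy (xy∉ , yx∉) t∈S with edge-ends xy
      ... | inj₁ eq = xy∉ (subst (_∈ map ends S) eq (∈-map⁺ ends t∈S))
      ... | inj₂ eq = yx∉ (subst (_∈ map ends S) eq (∈-map⁺ ends t∈S))

    -- A walk of G − ends(S) is followed in L − S by the edges it traverses.
    lineReach : ∀ {S x y} → ReachMinusEdges G (map ends S) x y →
                ∀ {a b} → a ∉ S → Incident x a → b ∉ S → Incident y b →
                Reach L (EdgeAvoidingVertices L S) a b
    lineReach here {a} {b} a∉S x∈a b∉S x∈b with a ≟ᴱ b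
    ... | yes refl = here
    ... | no a≢b = step (adj-line⁺ a≢b x∈a x∈b , b∉S) here
    lineReach (step (xz , xz-avoids) p) {a} a∉S x∈a b∉S y∈b with a ≟ᴱ edge xz
    ... | yes refl = lineReach p a∉S (proj₂ (SameEdge⇒Incident {edge xz} (edge-ends xz))) b∉S y∈b
    ... | no a≢xz =
      step (adj-line⁺ a≢xz x∈a (proj₁ (SameEdge⇒Incident {edge xz} (edge-ends xz))) , edge∉ xz xz-avoids)
           (lineReach p (edge∉ xz xz-avoids) (proj₂ (SameEdge⇒Incident {edge xz} (edge-ends xz))) b∉S y∈b)

    vertexConnected-line : ∀ {k} → NonIsolatedConnected G k → VertexConnected L k
    vertexConnected-line {k} connected S S<k a b a∉S b∉S =
      lineReach (connected (map ends S) (subst (_< k) (sym (length-map ends S)) S<k) _ _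
                           (nonIsolated a∉S) (nonIsolated b∉S))
                a∉S (inj₁ refl) b∉S (inj₁ refl)
      where
      nonIsolated : ∀ {t} → t ∉ S → NonIsolatedMinusEdges G (map ends S) (proj₁ (ends t))
      nonIsolated {t} t∉S =
        proj₂ (ends t) , proj₂ (proj₂ t) , t∉S ∘ Deleted-ends⇒∈ {S} {t} ∘ inj₁ , t∉S ∘ Deleted-ends⇒∈ {S} {t} ∘ inj₂

    module _ (triangleFree : TriangleFree G) {u v w z} (uv : adj G u v ≡ true) (vw : adj G v w ≡ true)
             (w≢u : w ≢ u) (wz : adj G w z ≡ true) (z≢v : z ≢ v) where

      private
        noSharedEnd : ∀ {x} → Incident x (edge uv) → Incident x (edge wz) → ⊥
        noSharedEnd x∈uv x∈wz
          with Incident-SameEdge {edge uv} (edge-ends uv) x∈uv | Incident-SameEdge {edge wz} (edge-ends wz) x∈wz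
        ... | inj₁ refl | inj₁ refl = w≢u refl
        ... | inj₁ refl | inj₂ refl = triangleFree uv vw (adj-sym wz)
        ... | inj₂ refl | inj₁ refl = adj-irrefl vw
        ... | inj₂ refl | inj₂ refl = z≢v refl

      pathEnds-distinct : edge uv ≢ edge wz
      pathEnds-distinct eq =
        noSharedEnd (proj₁ (SameEdge⇒Incident {edge uv} (edge-ends uv)))
                    (subst (Incident u) eq (proj₁ (SameEdge⇒Incident {edge uv} (edge-ends uv))))

      pathEnds-nonadjacent : adj L (edge uv) (edge wz) ≢ true
      pathEnds-nonadjacent uv~wz with adj-line⁻ {edge uv} {edge wz} uv~wz
      ... | _ , _ , x∈uv , x∈wz = noSharedEnd x∈uv x∈wz

    private
      others-nonempty : 2 ≤ d → ∀ {x y} → adj G x y ≡ true → 0 < length (neighboursExcept x y)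
      others-nonempty 2≤d xy = ≤-pred (subst (2 ≤_) (sym (length-neighboursExcept xy)) 2≤d)

    nonComplete-line : TriangleFree G → 2 ≤ d → V G → NonComplete L
    nonComplete-line triangleFree 2≤d u
      with ∃∈-of-length> (subst (0 <_) (sym (length-neighbours u)) (≤-trans (s≤s z≤n) 2≤d))
    ... | v , v∈ with ∃∈-of-length> (others-nonempty 2≤d (adj-sym (∈-neighbours⁻ v∈)))
    ... | w , w∈ with ∃∈-of-length> (others-nonempty 2≤d (adj-sym (proj₁ (∈-neighboursExcept⁻ v u w∈))))
    ... | z , z∈ = edge uv , edge wz , pathEnds-distinct triangleFree uv vw w≢u wz z≢v ,
                   pathEnds-nonadjacent triangleFree uv vw w≢u wz z≢v
      where
      uv : adj G u v ≡ true
      uv = ∈-neighbours⁻ v∈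
      vw : adj G v w ≡ true
      vw = proj₁ (∈-neighboursExcept⁻ v u w∈)
      w≢u : w ≢ u
      w≢u = proj₂ (∈-neighboursExcept⁻ v u w∈)
      wz : adj G w z ≡ true
      wz = proj₁ (∈-neighboursExcept⁻ w v z∈)
      z≢v : z ≢ v
      z≢v = proj₂ (∈-neighboursExcept⁻ w v z∈)

-- Hypercube-like networks

Adj : ℕ → Set
Adj n = BitVec n → BitVec n → Bool

lexLt-asym : ∀ {n} {x y : BitVec n} → lexLt x y ≡ true → lexLt y x ≡ true → ⊥
lexLt-asym {x = []} {[]} () _
lexLt-asym {x = false ∷ x} {false ∷ y} xy yx = lexLt-asym {x = x} xy yx
lexLt-asym {x = true ∷ x} {true ∷ y} xy yx = lexLt-asym {x = x} xy yx

lexLt-connex : ∀ {n} {x y : BitVec n} → x ≢ y → lexLt x y ≡ true ⊎ lexLt y x ≡ true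
lexLt-connex {x = []} {[]} x≢y = contradiction refl x≢y
lexLt-connex {x = false ∷ x} {false ∷ y} x≢y = lexLt-connex (x≢y ∘ cong (false ∷_))
lexLt-connex {x = false ∷ x} {true ∷ y} _ = inj₁ refl
lexLt-connex {x = true ∷ x} {false ∷ y} _ = inj₂ refl
lexLt-connex {x = true ∷ x} {true ∷ y} x≢y = lexLt-connex (x≢y ∘ cong (true ∷_))

module _ {m} (F : BitVec m ⤖ BitVec m) where
  open Bijection F using (to; to⁻; injective)

  to∘to⁻ : ∀ y → to (to⁻ y) ≡ y
  to∘to⁻ = Surjection.to∘to⁻ (Bijection.surjection F)

  to⁻∘to : ∀ x → to⁻ (to x) ≡ x
  to⁻∘to x = injective (to∘to⁻ (to x))

hl-sym : ∀ {n R} → IsHL n R → ∀ {x y} → R x y ≡ true → R y x ≡ true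
hl-sym base {false ∷ []} {true ∷ []} xy = refl
hl-sym base {true ∷ []} {false ∷ []} xy = refl
hl-sym (step h₁ h₂ F) {false ∷ x} {false ∷ y} xy = hl-sym h₁ xy
hl-sym (step h₁ h₂ F) {false ∷ x} {true ∷ y} xy = xy
hl-sym (step h₁ h₂ F) {true ∷ x} {false ∷ y} xy = xy
hl-sym (step h₁ h₂ F) {true ∷ x} {true ∷ y} xy = hl-sym h₂ xy

hl-irrefl : ∀ {n R} → IsHL n R → ∀ {x} → R x x ≢ true
hl-irrefl base {false ∷ []} ()
hl-irrefl base {true ∷ []} ()
hl-irrefl (step h₁ h₂ F) {false ∷ x} = hl-irrefl h₁
hl-irrefl (step h₁ h₂ F) {true ∷ x} = hl-irrefl h₂

hl-positive : ∀ {n R} → IsHL n R → 1 ≤ n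
hl-positive base = s≤s z≤n
hl-positive (step _ _ _) = s≤s z≤n

hl-≢ : ∀ {n R} → IsHL n R → ∀ {x y} → R x y ≡ true → x ≢ y
hl-≢ h xy refl = hl-irrefl h xy

hl-triangleFree : ∀ {n R} → IsHL n R → TriangleFree (hlGraph n R)
hl-triangleFree base {false ∷ []} {false ∷ []} ()
hl-triangleFree base {false ∷ []} {true ∷ []} {false ∷ []} _ _ ()
hl-triangleFree base {false ∷ []} {true ∷ []} {true ∷ []} _ ()
hl-triangleFree base {true ∷ []} {false ∷ []} {false ∷ []} _ ()
hl-triangleFree base {true ∷ []} {false ∷ []} {true ∷ []} _ _ ()
hl-triangleFree base {true ∷ []} {true ∷ []} ()
hl-triangleFree (step h₁ h₂ F) {false ∷ x} {false ∷ y} {false ∷ z} = hl-triangleFree h₁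
hl-triangleFree (step h₁ h₂ F) {true ∷ x} {true ∷ y} {true ∷ z} = hl-triangleFree h₂
hl-triangleFree (step h₁ h₂ F) {false ∷ x} {false ∷ y} {true ∷ z} xy yz xz =
  hl-≢ h₁ xy (Bijection.injective F (trans (isYes-true (_ ≟V z) xz) (sym (isYes-true (_ ≟V z) yz))))
hl-triangleFree (step h₁ h₂ F) {false ∷ x} {true ∷ y} {false ∷ z} xy yz xz =
  hl-≢ h₁ xz (Bijection.injective F (trans (isYes-true (_ ≟V y) xy) (sym (isYes-true (_ ≟V y) yz))))
hl-triangleFree (step h₁ h₂ F) {true ∷ x} {false ∷ y} {false ∷ z} xy yz xz =
  hl-≢ h₁ yz (Bijection.injective F (trans (isYes-true (_ ≟V x) xy) (sym (isYes-true (_ ≟V x) xz))))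
hl-triangleFree (step h₁ h₂ F) {false ∷ x} {true ∷ y} {true ∷ z} xy yz xz =
  hl-≢ h₂ yz (trans (sym (isYes-true (_ ≟V y) xy)) (isYes-true (_ ≟V z) xz))
hl-triangleFree (step h₁ h₂ F) {true ∷ x} {false ∷ y} {true ∷ z} xy yz xz =
  hl-≢ h₂ xz (trans (sym (isYes-true (_ ≟V x) xy)) (isYes-true (_ ≟V z) yz))
hl-triangleFree (step h₁ h₂ F) {true ∷ x} {true ∷ y} {false ∷ z} xy yz xz =
  hl-≢ h₂ xy (trans (sym (isYes-true (_ ≟V x) xz)) (isYes-true (_ ≟V y) yz))

hl-neighbours : ∀ {n R} → IsHL n R → BitVec n → List (BitVec n)
hl-neighbours base (b ∷ []) = (not b ∷ []) ∷ []
hl-neighbours (step h₁ h₂ F) (false ∷ x) = (true ∷ Bijection.to F x) ∷ map (false ∷_) (hl-neighbours h₁ x)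
hl-neighbours (step h₁ h₂ F) (true ∷ x) = (false ∷ Bijection.to⁻ F x) ∷ map (true ∷_) (hl-neighbours h₂ x)

∈-hl-neighbours⁺ : ∀ {n R} (h : IsHL n R) {x y} → R x y ≡ true → y ∈ hl-neighbours h x
∈-hl-neighbours⁺ base {false ∷ []} {true ∷ []} _ = here refl
∈-hl-neighbours⁺ base {true ∷ []} {false ∷ []} _ = here refl
∈-hl-neighbours⁺ (step h₁ h₂ F) {false ∷ x} {false ∷ y} xy = there (∈-map⁺ (false ∷_) (∈-hl-neighbours⁺ h₁ xy))
∈-hl-neighbours⁺ (step h₁ h₂ F) {true ∷ x} {true ∷ y} xy = there (∈-map⁺ (true ∷_) (∈-hl-neighbours⁺ h₂ xy))
∈-hl-neighbours⁺ (step h₁ h₂ F) {false ∷ x} {true ∷ y} xy =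
  here (cong (true ∷_) (sym (isYes-true (_ ≟V y) xy)))
∈-hl-neighbours⁺ (step h₁ h₂ F) {true ∷ x} {false ∷ y} xy =
  here (cong (false ∷_) (trans (sym (to⁻∘to F y)) (cong (Bijection.to⁻ F) (isYes-true (_ ≟V x) xy))))

∈-hl-neighbours⁻ : ∀ {n R} (h : IsHL n R) {x y} → y ∈ hl-neighbours h x → R x y ≡ true
∈-hl-neighbours⁻ base {false ∷ []} (here refl) = refl
∈-hl-neighbours⁻ base {true ∷ []} (here refl) = refl
∈-hl-neighbours⁻ (step h₁ h₂ F) {false ∷ x} (here refl) = isYes-intro (_ ≟V _) refl
∈-hl-neighbours⁻ (step h₁ h₂ F) {true ∷ x} (here refl) = isYes-intro (_ ≟V x) (to∘to⁻ F x)
∈-hl-neighbours⁻ (step h₁ h₂ F) {false ∷ x} (there y∈) with ∈-map⁻ (false ∷_) y∈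
... | _ , y∈′ , refl = ∈-hl-neighbours⁻ h₁ y∈′
∈-hl-neighbours⁻ (step h₁ h₂ F) {true ∷ x} (there y∈) with ∈-map⁻ (true ∷_) y∈
... | _ , y∈′ , refl = ∈-hl-neighbours⁻ h₂ y∈′

Unique-hl-neighbours : ∀ {n R} (h : IsHL n R) x → Unique (hl-neighbours h x)
Unique-hl-neighbours base (b ∷ []) = [] ∷ []
Unique-hl-neighbours (step h₁ h₂ F) (false ∷ x) =
  All.map⁺ (All.tabulate (λ _ ())) ∷ Unique.map⁺ ∷-injectiveʳ (Unique-hl-neighbours h₁ x)
Unique-hl-neighbours (step h₁ h₂ F) (true ∷ x) =
  All.map⁺ (All.tabulate (λ _ ())) ∷ Unique.map⁺ ∷-injectiveʳ (Unique-hl-neighbours h₂ x)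

length-hl-neighbours : ∀ {n R} (h : IsHL n R) x → length (hl-neighbours h x) ≡ n
length-hl-neighbours base (b ∷ []) = refl
length-hl-neighbours (step h₁ h₂ F) (false ∷ x) =
  cong suc (trans (length-map (false ∷_) (hl-neighbours h₁ x)) (length-hl-neighbours h₁ x))
length-hl-neighbours (step h₁ h₂ F) (true ∷ x) =
  cong suc (trans (length-map (true ∷_) (hl-neighbours h₂ x)) (length-hl-neighbours h₂ x))

hl-simpleRegular : ∀ {n R} → IsHL n R → SimpleRegular (hlGraph n R) n
hl-simpleRegular h = record
  { adj-sym           = hl-sym h
  ; adj-irrefl        = hl-irrefl h
  ; neighbours        = hl-neighbours h
  ; ∈-neighbours⁺     = ∈-hl-neighbours⁺ h
  ; ∈-neighbours⁻     = ∈-hl-neighbours⁻ h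
  ; neighbours-unique = Unique-hl-neighbours h
  ; length-neighbours = length-hl-neighbours h
  }

-- Deleting edges from G₁ ⊕_f G₂

toggle : ∀ {m} → BitVec (suc m) → BitVec (suc m)
toggle (b ∷ x) = not b ∷ x

toggle-involutive : ∀ {m} (x : BitVec (suc m)) → toggle (toggle x) ≡ x
toggle-involutive (false ∷ x) = refl
toggle-involutive (true ∷ x) = refl

both : ∀ {A : Set} → (A → A) → A × A → A × A
both φ (x , y) = φ x , φ y

toggleEdge : ∀ {m} → BitVec (suc m) × BitVec (suc m) → BitVec (suc m) × BitVec (suc m)
toggleEdge = both toggle

innerEdges₁ : ∀ {m} → List (BitVec (suc m) × BitVec (suc m)) → List (BitVec m × BitVec m)
innerEdges₁ [] = []
innerEdges₁ ((false ∷ x , false ∷ y) ∷ F) = (x , y) ∷ innerEdges₁ F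
innerEdges₁ (_ ∷ F) = innerEdges₁ F

innerEdges₂ : ∀ {m} → List (BitVec (suc m) × BitVec (suc m)) → List (BitVec m × BitVec m)
innerEdges₂ F = innerEdges₁ (map toggleEdge F)

∈-innerEdges₁ : ∀ {m} {F : List (BitVec (suc m) × BitVec (suc m))} {x y} →
                (false ∷ x , false ∷ y) ∈ F → (x , y) ∈ innerEdges₁ F
∈-innerEdges₁ (here refl) = here refl
∈-innerEdges₁ {F = (false ∷ _ , false ∷ _) ∷ _} (there xy∈) = there (∈-innerEdges₁ xy∈)
∈-innerEdges₁ {F = (false ∷ _ , true ∷ _) ∷ _} (there xy∈) = ∈-innerEdges₁ xy∈
∈-innerEdges₁ {F = (true ∷ _ , _ ∷ _) ∷ _} (there xy∈) = ∈-innerEdges₁ xy∈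

∈-innerEdges₂ : ∀ {m} {F : List (BitVec (suc m) × BitVec (suc m))} {x y} →
                (true ∷ x , true ∷ y) ∈ F → (x , y) ∈ innerEdges₂ F
∈-innerEdges₂ xy∈ = ∈-innerEdges₁ (∈-map⁺ toggleEdge xy∈)

length-innerEdges : ∀ {m} (F : List (BitVec (suc m) × BitVec (suc m))) →
                    length (innerEdges₁ F) + length (innerEdges₂ F) ≤ length F
length-innerEdges [] = z≤n
length-innerEdges ((false ∷ _ , false ∷ _) ∷ F) = s≤s (length-innerEdges F)
length-innerEdges ((false ∷ _ , true ∷ _) ∷ F) = m≤n⇒m≤1+n (length-innerEdges F)
length-innerEdges ((true ∷ _ , false ∷ _) ∷ F) = m≤n⇒m≤1+n (length-innerEdges F)
length-innerEdges ((true ∷ _ , true ∷ _) ∷ F) =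
  subst (_≤ suc (length F)) (sym (+-suc (length (innerEdges₁ F)) _)) (s≤s (length-innerEdges F))

innerEdges₂-toggle : ∀ {m} (F : List (BitVec (suc m) × BitVec (suc m))) →
                     innerEdges₂ (map toggleEdge F) ≡ innerEdges₁ F
innerEdges₂-toggle F = cong innerEdges₁ (begin
  map toggleEdge (map toggleEdge F)  ≡⟨ map-∘ F ⟨
  map (toggleEdge ∘ toggleEdge) F    ≡⟨ map-cong (λ (x , y) → cong₂ _,_ (toggle-involutive x) (toggle-involutive y)) F ⟩
  map id F                           ≡⟨ map-id F ⟩
  F                                  ∎)
  where open ≡-Reasoning

module Transport {n} (R R′ : Adj n) (φ : BitVec n → BitVec n) (φ-involutive : ∀ x → φ (φ x) ≡ x)
                 (φ-iso : ∀ x y → R′ (φ x) (φ y) ≡ R x y) where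

  private
    φ-injective : ∀ {x y} → φ x ≡ φ y → x ≡ y
    φ-injective {x} {y} φx≡φy = trans (sym (φ-involutive x)) (trans (cong φ φx≡φy) (φ-involutive y))

    reach-transport′ : ∀ {F x y} → ReachMinusEdges (hlGraph n R′) (map (both φ) F) x y →
                       ReachMinusEdges (hlGraph n R) F (φ x) (φ y)
    reach-transport′ here = here
    reach-transport′ {F} {x} (step {w = z} (xz , xz∉ , zx∉) p) =
      step (φxφz , xz∉ ∘ back , zx∉ ∘ back) (reach-transport′ p)
      where
      φxφz : R (φ x) (φ z) ≡ true
      φxφz = trans (sym (φ-iso (φ x) (φ z))) (trans (cong₂ R′ (φ-involutive x) (φ-involutive z)) xz)
      back : ∀ {u v} → (φ u , φ v) ∈ F → (u , v) ∈ map (both φ) F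
      back {u} {v} e∈ = subst (_∈ map (both φ) F) (cong₂ _,_ (φ-involutive u) (φ-involutive v))
                              (∈-map⁺ (both φ) e∈)

  reach-transport : ∀ {F x y} → ReachMinusEdges (hlGraph n R′) (map (both φ) F) (φ x) (φ y) →
                    ReachMinusEdges (hlGraph n R) F x y
  reach-transport {F} {x} {y} p =
    subst₂ (ReachMinusEdges (hlGraph n R) F) (φ-involutive x) (φ-involutive y) (reach-transport′ p)

  nonIsolated-transport : ∀ {F x} → NonIsolatedMinusEdges (hlGraph n R) F x →
                          NonIsolatedMinusEdges (hlGraph n R′) (map (both φ) F) (φ x)
  nonIsolated-transport {F} {x} (w , xw , xw∉ , wx∉) =
    φ w , trans (φ-iso x w) xw , xw∉ ∘ back , wx∉ ∘ back
    where
    back : ∀ {u v} → (φ u , φ v) ∈ map (both φ) F → (u , v) ∈ F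
    back e∈ with ∈-map⁻ (both φ) e∈
    ... | _ , e∈F , eq = subst (_∈ F) (sym (cong₂ _,_ (φ-injective (cong proj₁ eq)) (φ-injective (cong proj₂ eq)))) e∈F

oplus-toggle : ∀ {m} (R₁ R₂ : Adj m) (F : BitVec m ⤖ BitVec m) x y →
               oplus R₂ R₁ (Bijection.to⁻ F) (toggle x) (toggle y) ≡ oplus R₁ R₂ (Bijection.to F) x y
oplus-toggle R₁ R₂ F (false ∷ a) (false ∷ b) = refl
oplus-toggle R₁ R₂ F (false ∷ a) (true ∷ b) =
  isYes-≡ (_ ≟V a) (_ ≟V b) (λ { refl → to∘to⁻ F b }) (λ { refl → to⁻∘to F a })
oplus-toggle R₁ R₂ F (true ∷ a) (false ∷ b) =
  isYes-≡ (_ ≟V b) (_ ≟V a) (λ { refl → to∘to⁻ F a }) (λ { refl → to⁻∘to F b })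
oplus-toggle R₁ R₂ F (true ∷ a) (true ∷ b) = refl

module Oplus {m} (R₁ R₂ : Adj m) (f : BitVec m → BitVec m) where

  G : Graph
  G = hlGraph (suc m) (oplus R₁ R₂ f)

  cross : BitVec m → BitVec (suc m) × BitVec (suc m)
  cross x = false ∷ x , true ∷ f x

  inner : BitVec m → BitVec m → BitVec (suc m) × BitVec (suc m)
  inner x y = false ∷ x , false ∷ y

  cross-adj : ∀ x → oplus R₁ R₂ f (false ∷ x) (true ∷ f x) ≡ true
  cross-adj x = isYes-intro (f x ≟V f x) refl

  oplus-sym : (∀ {x y} → R₁ x y ≡ true → R₁ y x ≡ true) → (∀ {x y} → R₂ x y ≡ true → R₂ y x ≡ true) →
              ∀ {x y} → oplus R₁ R₂ f x y ≡ true → oplus R₁ R₂ f y x ≡ true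
  oplus-sym sym₁ sym₂ {false ∷ x} {false ∷ y} = sym₁
  oplus-sym sym₁ sym₂ {false ∷ x} {true ∷ y} = id
  oplus-sym sym₁ sym₂ {true ∷ x} {false ∷ y} = id
  oplus-sym sym₁ sym₂ {true ∷ x} {true ∷ y} = sym₂

  lift₂ : ∀ {F a b} → ReachMinusEdges (hlGraph m R₂) (innerEdges₂ F) a b →
          ReachMinusEdges G F (true ∷ a) (true ∷ b)
  lift₂ here = here
  lift₂ (step (ab , ab∉ , ba∉) p) = step (ab , ab∉ ∘ ∈-innerEdges₂ , ba∉ ∘ ∈-innerEdges₂) (lift₂ p)

  Blocker : BitVec m → BitVec m → BitVec (suc m) × BitVec (suc m) → Set
  Blocker k d e = e ≡ inner k d ⊎ e ≡ cross d

  Blocker-SameEdge : ∀ {k d e k′ d′ e′} → Blocker k d e → Blocker k′ d′ e′ → SameEdge e e′ →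
                     d ≡ d′ ⊎ (k ≡ d′ × d ≡ k′)
  Blocker-SameEdge (inj₁ refl) (inj₁ refl) (inj₁ refl) = inj₁ refl
  Blocker-SameEdge (inj₁ refl) (inj₁ refl) (inj₂ refl) = inj₂ (refl , refl)
  Blocker-SameEdge (inj₂ refl) (inj₂ refl) (inj₁ refl) = inj₁ refl
  Blocker-SameEdge (inj₁ refl) (inj₂ refl) (inj₁ ())
  Blocker-SameEdge (inj₁ refl) (inj₂ refl) (inj₂ ())
  Blocker-SameEdge (inj₂ refl) (inj₁ refl) (inj₁ ())
  Blocker-SameEdge (inj₂ refl) (inj₁ refl) (inj₂ ())
  Blocker-SameEdge (inj₂ refl) (inj₂ refl) (inj₂ ())

  cross-SameEdge-Blocker : ∀ {x k d e} → Blocker k d e → SameEdge (cross x) e → x ≡ d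
  cross-SameEdge-Blocker (inj₁ refl) (inj₁ ())
  cross-SameEdge-Blocker (inj₁ refl) (inj₂ ())
  cross-SameEdge-Blocker (inj₂ refl) (inj₁ refl) = refl
  cross-SameEdge-Blocker (inj₂ refl) (inj₂ ())

  module Escape (reg₁ : SimpleRegular (hlGraph m R₁) m) (triangleFree₁ : TriangleFree (hlGraph m R₁))
                (F : List (BitVec (suc m) × BitVec (suc m))) (F<2m : length F < 2 * m) where
    open SimpleRegular reg₁
    open SimpleRegularProperties _≟V_ reg₁

    Route : BitVec m → BitVec m → Set
    Route k d = Avoids F (inner k d) × Avoids F (cross d)

    route? : ∀ k d → Dec (Route k d)
    route? k d = avoids? _≟V_ F (inner k d) ×-dec avoids? _≟V_ F (cross d)

    blocker : BitVec m → BitVec m → BitVec (suc m) × BitVec (suc m)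
    blocker k d with avoids? _≟V_ F (inner k d)
    ... | yes _ = cross d
    ... | no _ = inner k d

    blocker-Blocker : ∀ k d → Blocker k d (blocker k d)
    blocker-Blocker k d with avoids? _≟V_ F (inner k d)
    ... | yes _ = inj₂ refl
    ... | no _ = inj₁ refl

    blocker-deleted : ∀ {k d} → ¬ Route k d → Deleted F (blocker k d)
    blocker-deleted {k} {d} ¬route with avoids? _≟V_ F (inner k d)
    ... | yes inner-free = ¬avoids⇒deleted _≟V_ (λ cross-free → ¬route (inner-free , cross-free))
    ... | no inner-cut = ¬avoids⇒deleted _≟V_ inner-cut

    -- If none of the routes a → G₂, c → G₂, a → d → G₂ (d ∼ a) and c → d → G₂ (d ∼ c) survives,
    -- then F contains 2 + (m − 1) + (m − 1) pairwise distinct edges, one on each route.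
    module Stuck {a c} (ac : R₁ a c ≡ true) (a-cut : Deleted F (cross a)) (c-cut : Deleted F (cross c))
                 (a-stuck : All (¬_ ∘ Route a) (neighboursExcept a c))
                 (c-stuck : All (¬_ ∘ Route c) (neighboursExcept c a)) where

      blockingEdges : List (BitVec (suc m) × BitVec (suc m))
      blockingEdges = cross a ∷ cross c ∷
        map (blocker a) (neighboursExcept a c) ++ map (blocker c) (neighboursExcept c a)

      blockingEdges-deleted : All (Deleted F) blockingEdges
      blockingEdges-deleted = a-cut ∷ c-cut ∷
        All.++⁺ (All.map⁺ (All.map blocker-deleted a-stuck)) (All.map⁺ (All.map blocker-deleted c-stuck))

      private
        cross≁blocker : ∀ {x k d} → x ≢ d → ¬ SameEdge (cross x) (blocker k d)
        cross≁blocker {k = k} {d} x≢d = x≢d ∘ cross-SameEdge-Blocker (blocker-Blocker k d)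

        blocker≁blocker : ∀ {k d d′} → d ≢ d′ → ¬ SameEdge (blocker k d) (blocker k d′)
        blocker≁blocker {k} {d} {d′} d≢d′ same
          with Blocker-SameEdge (blocker-Blocker k d) (blocker-Blocker k d′) same
        ... | inj₁ d≡d′ = d≢d′ d≡d′
        ... | inj₂ (k≡d′ , d≡k) = d≢d′ (trans d≡k k≡d′)

        blockerₐ≁blocker꜀ : ∀ {d d′} → d ∈ neighboursExcept a c → d′ ∈ neighboursExcept c a →
                            ¬ SameEdge (blocker a d) (blocker c d′)
        blockerₐ≁blocker꜀ {d} {d′} d∈ d′∈ same
          with Blocker-SameEdge (blocker-Blocker a d) (blocker-Blocker c d′) same
        ... | inj₁ refl = triangleFree₁ ac (proj₁ (∈-neighboursExcept⁻ c a d′∈)) (proj₁ (∈-neighboursExcept⁻ a c d∈))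
        ... | inj₂ (_ , d≡c) = proj₂ (∈-neighboursExcept⁻ a c d∈) d≡c

        head≢ : ∀ {x y d} → d ∈ neighboursExcept x y → x ≢ d × y ≢ d
        head≢ {x} {y} d∈ = adj⇒≢ (proj₁ (∈-neighboursExcept⁻ x y d∈)) , proj₂ (∈-neighboursExcept⁻ x y d∈) ∘ sym

      blockingEdges-distinct : AllPairs (λ e e′ → ¬ SameEdge e e′) blockingEdges
      blockingEdges-distinct =
        ((λ same → adj⇒≢ ac (cross-SameEdge-Blocker {k = a} (inj₂ refl) same)) ∷
          All.++⁺ (All.map⁺ (All.tabulate (cross≁blocker ∘ proj₁ ∘ head≢)))
                  (All.map⁺ (All.tabulate (cross≁blocker ∘ proj₂ ∘ head≢)))) ∷
        All.++⁺ (All.map⁺ (All.tabulate (cross≁blocker ∘ proj₂ ∘ head≢)))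
                (All.map⁺ (All.tabulate (cross≁blocker ∘ proj₁ ∘ head≢))) ∷
        AllPairs.++⁺ (AllPairs.map⁺ (AllPairs.map blocker≁blocker (Unique-neighboursExcept a c)))
                     (AllPairs.map⁺ (AllPairs.map blocker≁blocker (Unique-neighboursExcept c a)))
                     (All.map⁺ (All.tabulate λ d∈ → All.map⁺ (All.tabulate λ d′∈ → blockerₐ≁blocker꜀ d∈ d′∈)))

      length-blockingEdges : length blockingEdges ≡ 2 * m
      length-blockingEdges = begin
        2 + length (map (blocker a) (neighboursExcept a c) ++ map (blocker c) (neighboursExcept c a))
          ≡⟨ cong (2 +_) (length-++ (map (blocker a) (neighboursExcept a c))) ⟩
        2 + (length (map (blocker a) (neighboursExcept a c)) + length (map (blocker c) (neighboursExcept c a)))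
          ≡⟨ cong (2 +_) (cong₂ _+_ (length-map (blocker a) (neighboursExcept a c))
                                    (length-map (blocker c) (neighboursExcept c a))) ⟩
        2 + (length (neighboursExcept a c) + length (neighboursExcept c a))
          ≡⟨ suc+suc≡2* (length-neighboursExcept ac) (length-neighboursExcept (adj-sym ac)) ⟩
        2 * m ∎
        where open ≡-Reasoning

      impossible : ⊥
      impossible = <⇒≱ F<2m (subst (_≤ length F) length-blockingEdges
                                   (distinct-deleted-length≤ _≟V_ F blockingEdges-distinct blockingEdges-deleted))

    escape : ∀ {a c} → R₁ a c ≡ true → Avoids F (inner a c) →
             ∃ λ b → ReachMinusEdges G F (false ∷ a) (true ∷ b)
    escape {a} {c} ac ac-free with avoids? _≟V_ F (cross a)
    ... | yes a-free = f a , step (cross-adj a , a-free) here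
    ... | no a-cut with avoids? _≟V_ F (cross c)
    ...   | yes c-free = f c , step (ac , ac-free) (step (cross-adj c , c-free) here)
    ...   | no c-cut with any? (route? a) (neighboursExcept a c) | any? (route? c) (neighboursExcept c a)
    ...     | yes viaₐ | _ with find viaₐ
    ...       | d , d∈ , ad-free , d-free =
      f d , step (proj₁ (∈-neighboursExcept⁻ a c d∈) , ad-free) (step (cross-adj d , d-free) here)
    escape {a} {c} ac ac-free | no _ | no _ | no _ | yes via꜀ with find via꜀
    ...       | d , d∈ , cd-free , d-free =
      f d , step (ac , ac-free) (step (proj₁ (∈-neighboursExcept⁻ c a d∈) , cd-free) (step (cross-adj d , d-free) here))
    escape {a} {c} ac ac-free | no a-cut | no c-cut | no noneₐ | no none꜀ =
      ⊥-elim (Stuck.impossible ac (¬avoids⇒deleted _≟V_ a-cut) (¬avoids⇒deleted _≟V_ c-cut)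
                               (¬Any⇒All¬ _ noneₐ) (¬Any⇒All¬ _ none꜀))

    reachCopy₂ : ∀ {x} → NonIsolatedMinusEdges G F x → ∃ λ b → ReachMinusEdges G F x (true ∷ b)
    reachCopy₂ {true ∷ b} _ = b , here
    reachCopy₂ {false ∷ a} (true ∷ b , ab-free) = b , step ab-free here
    reachCopy₂ {false ∷ a} (false ∷ c , ac , ac-free) = escape ac ac-free

    reach-nonIsolated : (∀ {x y} → R₂ x y ≡ true → R₂ y x ≡ true) → ConnectedMinusEdges (hlGraph m R₂) (innerEdges₂ F) →
            ∀ x y → NonIsolatedMinusEdges G F x → NonIsolatedMinusEdges G F y → ReachMinusEdges G F x y
    reach-nonIsolated sym₂ connected₂ x y x-live y-live with reachCopy₂ x-live | reachCopy₂ y-live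
    ... | b , x→b | b′ , y→b′ =
      x→b ◅◅ lift₂ (connected₂ b b′) ◅◅ reverse symmetric y→b′
      where
      symmetric : ∀ {u w} → EdgeAvoidingEdges G F u w → EdgeAvoidingEdges G F w u
      symmetric {u} {w} (uw , uw∉ , wu∉) = oplus-sym adj-sym sym₂ {u} {w} uw , wu∉ , uw∉

nonIsolatedConnected-oplus :
  ∀ {m R₁ R₂} → IsHL m R₁ → IsHL m R₂ → (F : BitVec m ⤖ BitVec m) →
  EdgeConnected (hlGraph m R₁) m → EdgeConnected (hlGraph m R₂) m →
  NonIsolatedConnected (hlGraph (suc m) (oplus R₁ R₂ (Bijection.to F))) (2 * m)
nonIsolatedConnected-oplus {m} {R₁} {R₂} h₁ h₂ F λ₁ λ₂ S S<2m x y x-live y-live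
  with length (innerEdges₂ S) <? m
... | yes small₂ =
  Oplus.Escape.reach-nonIsolated R₁ R₂ (Bijection.to F) (hl-simpleRegular h₁) (hl-triangleFree h₁) S S<2m
    (hl-sym h₂) (λ₂ (innerEdges₂ S) small₂) x y x-live y-live
-- Toggling the first bit swaps the roles of the two copies, with f replaced by its inverse.
... | no big₂ =
  reach-transport
    (Oplus.Escape.reach-nonIsolated R₂ R₁ (Bijection.to⁻ F) (hl-simpleRegular h₂) (hl-triangleFree h₂)
      (map toggleEdge S) (subst (_< 2 * m) (sym (length-map toggleEdge S)) S<2m) (hl-sym h₁)
      (subst (ConnectedMinusEdges (hlGraph m R₁)) (sym (innerEdges₂-toggle S)) (λ₁ (innerEdges₁ S) small₁))
      (toggle x) (toggle y) (nonIsolated-transport x-live) (nonIsolated-transport y-live))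
  where
  open Transport (oplus R₁ R₂ (Bijection.to F)) (oplus R₂ R₁ (Bijection.to⁻ F))
                 toggle toggle-involutive (oplus-toggle R₁ R₂ F)
  small₁ : length (innerEdges₁ S) < m
  small₁ = a+b<m+m⇒a<m _ (≤-<-trans (length-innerEdges S) (subst (length S <_) (2*≡+ m) S<2m)) (≮⇒≥ big₂)

edgeConnected-HL : ∀ {n R} → IsHL n R → EdgeConnected (hlGraph n R) n
edgeConnected-HL base [] _ (false ∷ []) (false ∷ []) = here
edgeConnected-HL base [] _ (false ∷ []) (true ∷ []) = step (refl , (λ ()) , (λ ())) here
edgeConnected-HL base [] _ (true ∷ []) (false ∷ []) = step (refl , (λ ()) , (λ ())) here
edgeConnected-HL base [] _ (true ∷ []) (true ∷ []) = here
edgeConnected-HL base (_ ∷ _) (s≤s ())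
edgeConnected-HL (step {m} h₁ h₂ F) S S<1+m x y =
  nonIsolatedConnected-oplus h₁ h₂ F (edgeConnected-HL h₁) (edgeConnected-HL h₂) S (<-≤-trans S<1+m 1+m≤2m)
    x y (live x) (live y)
  where
  live : ∀ z → NonIsolatedMinusEdges (hlGraph (suc m) (oplus _ _ (Bijection.to F))) S z
  live = SimpleRegularProperties.nonIsolated-of-length< _≟V_ (hl-simpleRegular (step h₁ h₂ F)) S<1+m
  1+m≤2m : suc m ≤ 2 * m
  1+m≤2m = subst₂ _≤_ (+-comm m 1) (sym (2*≡+ m)) (+-monoʳ-≤ m (hl-positive h₁))

nonIsolatedConnected-HL : ∀ {n R} → IsHL n R → NonIsolatedConnected (hlGraph n R) (2 * n ∸ 2)
nonIsolatedConnected-HL base _ ()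
nonIsolatedConnected-HL (step {m} h₁ h₂ F) =
  subst (NonIsolatedConnected _) (trans (2*≡+ m) (pred+pred≡2*∸2 {m} refl refl))
    (nonIsolatedConnected-oplus h₁ h₂ F (edgeConnected-HL h₁) (edgeConnected-HL h₂))

lemma2p4 : (n : ℕ) → 2 ≤ n → (R : BitVec n → BitVec n → Bool) → IsHL n R
           → IsVertexConnectivity (lineHL n R) (2 * n ∸ 2)
             × IsEdgeConnectivity (lineHL n R) (2 * n ∸ 2)
lemma2p4 n 2≤n R h = isVertexConnectivity nonComplete κ , isEdgeConnectivity nonComplete κ
  where
  reg : SimpleRegular (hlGraph n R) n
  reg = hl-simpleRegular h
  open LineGraph (hlGraph n R) _≟V_ lexLt (λ {x} → lexLt-asym {x = x}) lexLt-connex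
  open RegularConnectivity _≟ᴱ_ (simpleRegular-line reg)
  nonComplete : NonComplete L
  nonComplete = nonComplete-line reg (hl-triangleFree h) 2≤n (replicate n false)
  κ : VertexConnected L (2 * n ∸ 2)
  κ = vertexConnected-line reg (nonIsolatedConnected-HL h)
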